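{- Let $\{f_i\}_{i\ge1}$ be a stream of queries of sensitivity $\Delta$ and $\varepsilon_1,\varepsilon_2>0$. Then for any neighboring datasets $x,x'$, $\varepsilon(x,x')\le\varepsilon_1+2\varepsilon_2$. If the queries are monotonic, then for any neighboring datasets $\varepsilon(x,x')\le\varepsilon_1+\varepsilon_2$, and moreover $\varepsilon(x,x')+\varepsilon(x',x)\le\varepsilon_1+2\varepsilon_2$.
   Context: Let $\mathcal X$ be a data universe with a symmetric neighboring relation. Sensitivity $\Delta$: $|f(x)-f(x')|\le\Delta$ for all neighbors. A stream $\{f_i\}$ is monotonic if for any neighbors either $f_i(x)\le f_i(x')$ for all $i$ or $f_i(x)\ge f_i(x')$ for all $i$. One-sided privacy loss: $\Delta_k(x,x')=\max_{i<k}\max\{0,f_i(x')-f_i(x)\}$ ($0$ for $k=1$), $\varepsilon(x,x')=\sup_k\big(\frac{\varepsilon_1}{\Delta}\Delta_k(x,x')+\frac{\varepsilon_2}{\Delta}\max\{0,\Delta_k(x,x')-(f_k(x')-f_k(x))\}\big)$.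
   Formalization: The queries take rational values, and the sensitivity Δ and the parameters ε₁, ε₂ are rational. -}

module Defs where

open import Data.Nat using (ℕ; zero; suc)
open import Data.Rational using (ℚ; 0ℚ; _+_; _-_; _*_; _÷_; _⊔_; _≤_; _<_; ∣_∣; Positive)
open import Data.Rational.Properties using (pos⇒nonZero)
open import Data.Sum using (_⊎_)

-- A stream of queries f_1, f_2, ... over data universe X is encoded 0-based:
-- Stream X = ℕ → X → ℚ, where (f i) is the paper's f_{i+1}.
Stream : Set → Set
Stream X = ℕ → X → ℚ

HasSensitivity : {X : Set} → (X → X → Set) → Stream X → ℚ → Set
HasSensitivity {X} Nbr f Δ = ∀ (i : ℕ) (x x' : X) → Nbr x x' → ∣ f i x - f i x' ∣ ≤ Δ

Monotonic : {X : Set} → (X → X → Set) → Stream X → Set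
Monotonic {X} Nbr f = ∀ (x x' : X) → Nbr x x' →
  (∀ (i : ℕ) → f i x ≤ f i x') ⊎ (∀ (i : ℕ) → f i x' ≤ f i x)

-- DeltaK f x x' n is the paper's Δ_{n+1}(x,x') = max_{i<n+1} max{0, f_i(x') - f_i(x)}
-- (paper indices i ≥ 1; 0 when n = 0, i.e. k = 1).
DeltaK : {X : Set} → Stream X → X → X → ℕ → ℚ
DeltaK f x x' zero = 0ℚ
DeltaK f x x' (suc n) = DeltaK f x x' n ⊔ (f n x' - f n x)

-- The k-th term (k = n+1) inside the supremum defining ε(x,x').
lossTerm : {X : Set} → Stream X → (Δ ε₁ ε₂ : ℚ) → .{{Positive Δ}} → X → X → ℕ → ℚ
lossTerm f Δ ε₁ ε₂ {{p}} x x' n =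
  (_÷_ ε₁ Δ {{pos⇒nonZero Δ {{p}}}}) * DeltaK f x x' n
  + (_÷_ ε₂ Δ {{pos⇒nonZero Δ {{p}}}}) * (0ℚ ⊔ (DeltaK f x x' n - (f n x' - f n x)))

-- ε(x,x') ≤ B, i.e. sup_k (term_k) ≤ B, unfolded as: every term is ≤ B.
LossBoundedBy : {X : Set} → Stream X → (Δ ε₁ ε₂ : ℚ) → .{{Positive Δ}} → X → X → ℚ → Set
LossBoundedBy f Δ ε₁ ε₂ x x' B = ∀ (n : ℕ) → lossTerm f Δ ε₁ ε₂ x x' n ≤ B

-- ε(x,x') + ε(x',x) ≤ B, i.e. sup_k a_k + sup_l b_l ≤ B, unfolded as:
-- a_k + b_l ≤ B for all k, l.
LossSumBoundedBy : {X : Set} → Stream X → (Δ ε₁ ε₂ : ℚ) → .{{Positive Δ}} → X → X → ℚ → Set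
LossSumBoundedBy f Δ ε₁ ε₂ x x' B =
  ∀ (n m : ℕ) → lossTerm f Δ ε₁ ε₂ x x' n + lossTerm f Δ ε₁ ε₂ x' x m ≤ B

{-# OPTIONS --safe #-}
-- Write dᵢ = fᵢ(x') − fᵢ(x) and Dₖ = max{0, d₀, …, d_{k−1}}, so the k-th loss term is
-- (ε₁/Δ)·Dₖ + (ε₂/Δ)·max{0, Dₖ − dₖ}. Sensitivity gives |dᵢ| ≤ Δ, hence Dₖ ≤ Δ and
-- Dₖ − dₖ ≤ 2Δ. For a monotonic stream the dᵢ have one sign: if all dᵢ ≥ 0 then
-- Dₖ − dₖ ≤ Dₖ ≤ Δ, and if all dᵢ ≤ 0 then Dₖ = 0 and −dₖ ≤ Δ. So one direction costs at
-- most ε₁ + ε₂ and the opposite one at most ε₂.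
module Submission where

open import Defs
open import Data.Nat using (ℕ; zero; suc)
open import Data.Rational
  using (ℚ; 0ℚ; 1ℚ; _+_; _-_; -_; _*_; 1/_; _÷_; _⊔_; ∣_∣; _≤_; _<_; Positive; NonNegative; NonZero; nonNegative)
open import Data.Rational.Properties
open import Data.Rational.Solver using (module +-*-Solver)
open import Data.Product using (_×_; _,_)
open import Data.Sum using (inj₁; inj₂)
open import Relation.Binary.PropositionalEquality using (_≡_; refl; sym; trans; cong; cong₂; subst)

open +-*-Solver using (solve; _:+_; _:*_; con)

p≤∣p∣ : ∀ p → p ≤ ∣ p ∣
p≤∣p∣ p with ≤-total 0ℚ p
... | inj₁ 0≤p = ≤-reflexive (sym (0≤p⇒∣p∣≡p 0≤p))
... | inj₂ p≤0 = ≤-trans p≤0 (0≤∣p∣ p)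

-p≤∣p∣ : ∀ p → - p ≤ ∣ p ∣
-p≤∣p∣ p = ≤-trans (p≤∣p∣ (- p)) (≤-reflexive (∣-p∣≡∣p∣ p))

p≤q⇒0≤q-p : ∀ {p q} → p ≤ q → 0ℚ ≤ q - p
p≤q⇒0≤q-p {p} {q} p≤q = ≤-trans (≤-reflexive (sym (+-inverseʳ p))) (+-monoˡ-≤ (- p) p≤q)

p≤q⇒p-q≤0 : ∀ {p q} → p ≤ q → p - q ≤ 0ℚ
p≤q⇒p-q≤0 {p} {q} p≤q = ≤-trans (+-monoˡ-≤ (- q) p≤q) (≤-reflexive (+-inverseʳ q))

0≤q⇒p-q≤p : ∀ p {q} → 0ℚ ≤ q → p - q ≤ p
0≤q⇒p-q≤p p 0≤q = ≤-trans (+-monoʳ-≤ p (neg-antimono-≤ 0≤q)) (≤-reflexive (+-identityʳ p))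

0≤p⇒q≤p+q : ∀ {p} q → 0ℚ ≤ p → q ≤ p + q
0≤p⇒q≤p+q q 0≤p = ≤-trans (≤-reflexive (sym (+-identityˡ q))) (+-monoˡ-≤ q 0≤p)

DeltaK-lub : ∀ {X : Set} (f : Stream X) (x x' : X) {B : ℚ} → 0ℚ ≤ B →
  (∀ i → f i x' - f i x ≤ B) → ∀ n → DeltaK f x x' n ≤ B
DeltaK-lub f x x' 0≤B d≤B zero    = 0≤B
DeltaK-lub f x x' 0≤B d≤B (suc n) = ⊔-lub (DeltaK-lub f x x' 0≤B d≤B n) (d≤B n)

module Loss {X : Set} (f : Stream X) (Δ ε₁ ε₂ : ℚ) .{{_ : Positive Δ}}
            (0≤ε₁ : 0ℚ ≤ ε₁) (0≤ε₂ : 0ℚ ≤ ε₂) where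

  instance
    Δ≢0 : NonZero Δ
    Δ≢0 = pos⇒nonZero Δ

  0≤Δ : 0ℚ ≤ Δ
  0≤Δ = <⇒≤ (positive⁻¹ Δ)

  p≤u*Δ⇒[ε÷Δ]*p≤u*ε : ∀ {ε} → 0ℚ ≤ ε → ∀ {p} u → p ≤ u * Δ → (ε ÷ Δ) * p ≤ u * ε
  p≤u*Δ⇒[ε÷Δ]*p≤u*ε {ε} 0≤ε {p} u p≤u*Δ = begin
    ε * 1/ Δ * p           ≤⟨ *-monoˡ-≤-nonNeg (ε * 1/ Δ) {{0≤ε÷Δ}} p≤u*Δ ⟩
    ε * 1/ Δ * (u * Δ)     ≡⟨ solve 4 (λ e i u d → e :* i :* (u :* d) , u :* e :* (i :* d)) refl ε (1/ Δ) u Δ ⟩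
    u * ε * (1/ Δ * Δ)     ≡⟨ cong (u * ε *_) (*-inverseˡ Δ) ⟩
    u * ε * 1ℚ             ≡⟨ *-identityʳ (u * ε) ⟩
    u * ε                  ∎
    where
    open ≤-Reasoning
    0≤ε÷Δ : NonNegative (ε * 1/ Δ)
    0≤ε÷Δ = nonNeg*nonNeg⇒nonNeg ε {{nonNegative 0≤ε}} (1/ Δ) {{pos⇒nonNeg (1/ Δ) {{1/pos⇒pos Δ}}}}

  LossBoundedBy⇒LossSumBoundedBy : ∀ x x' {a b} → LossBoundedBy f Δ ε₁ ε₂ x x' a →
    LossBoundedBy f Δ ε₁ ε₂ x' x b → LossSumBoundedBy f Δ ε₁ ε₂ x x' (a + b)
  LossBoundedBy⇒LossSumBoundedBy x x' ≤a ≤b n m = +-mono-≤ (≤a n) (≤b m)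

  module _ (x x' : X) where

    D : ℕ → ℚ
    D = DeltaK f x x'

    d : ℕ → ℚ
    d i = f i x' - f i x

    lossTerm≤u*ε₁+v*ε₂ : ∀ n u v → D n ≤ u * Δ → 0ℚ ⊔ (D n - d n) ≤ v * Δ →
      lossTerm f Δ ε₁ ε₂ x x' n ≤ u * ε₁ + v * ε₂
    lossTerm≤u*ε₁+v*ε₂ n u v D≤u*Δ ≤v*Δ =
      +-mono-≤ (p≤u*Δ⇒[ε÷Δ]*p≤u*ε 0≤ε₁ u D≤u*Δ) (p≤u*Δ⇒[ε÷Δ]*p≤u*ε 0≤ε₂ v ≤v*Δ)

    module _ (∣d∣≤Δ : ∀ i → ∣ d i ∣ ≤ Δ) where

      D≤Δ : ∀ n → D n ≤ Δ
      D≤Δ = DeltaK-lub f x x' 0≤Δ (λ i → ≤-trans (p≤∣p∣ (d i)) (∣d∣≤Δ i))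

      -d≤Δ : ∀ i → - d i ≤ Δ
      -d≤Δ i = ≤-trans (-p≤∣p∣ (d i)) (∣d∣≤Δ i)

      Δ≡1*Δ : Δ ≡ 1ℚ * Δ
      Δ≡1*Δ = sym (*-identityˡ Δ)

      D≤1*Δ : ∀ n → D n ≤ 1ℚ * Δ
      D≤1*Δ n = ≤-trans (D≤Δ n) (≤-reflexive Δ≡1*Δ)

      max0≤Δ : ∀ {p} → p ≤ Δ → 0ℚ ⊔ p ≤ 1ℚ * Δ
      max0≤Δ p≤Δ = ≤-trans (⊔-lub 0≤Δ p≤Δ) (≤-reflexive Δ≡1*Δ)

      loss≤ε₁+2ε₂ : LossBoundedBy f Δ ε₁ ε₂ x x' (ε₁ + (1ℚ + 1ℚ) * ε₂)
      loss≤ε₁+2ε₂ n = begin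
        lossTerm f Δ ε₁ ε₂ x x' n   ≤⟨ lossTerm≤u*ε₁+v*ε₂ n 1ℚ (1ℚ + 1ℚ) (D≤1*Δ n)
                                         (≤-trans (⊔-lub (+-mono-≤ 0≤Δ 0≤Δ) (+-mono-≤ (D≤Δ n) (-d≤Δ n)))
                                                  (≤-reflexive Δ+Δ≡2*Δ)) ⟩
        1ℚ * ε₁ + (1ℚ + 1ℚ) * ε₂    ≡⟨ cong (_+ (1ℚ + 1ℚ) * ε₂) (*-identityˡ ε₁) ⟩
        ε₁ + (1ℚ + 1ℚ) * ε₂         ∎
        where
        open ≤-Reasoning
        Δ+Δ≡2*Δ : Δ + Δ ≡ (1ℚ + 1ℚ) * Δ
        Δ+Δ≡2*Δ = solve 1 (λ δ → δ :+ δ , (con 1ℚ :+ con 1ℚ) :* δ) refl Δ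

      increasing⇒loss≤ε₁+ε₂ : (∀ i → f i x ≤ f i x') → LossBoundedBy f Δ ε₁ ε₂ x x' (ε₁ + ε₂)
      increasing⇒loss≤ε₁+ε₂ x≤x' n = begin
        lossTerm f Δ ε₁ ε₂ x x' n   ≤⟨ lossTerm≤u*ε₁+v*ε₂ n 1ℚ 1ℚ (D≤1*Δ n)
                                         (max0≤Δ (≤-trans (0≤q⇒p-q≤p (D n) (p≤q⇒0≤q-p (x≤x' n))) (D≤Δ n))) ⟩
        1ℚ * ε₁ + 1ℚ * ε₂           ≡⟨ cong₂ _+_ (*-identityˡ ε₁) (*-identityˡ ε₂) ⟩
        ε₁ + ε₂                     ∎
        where open ≤-Reasoning

      decreasing⇒loss≤ε₂ : (∀ i → f i x' ≤ f i x) → LossBoundedBy f Δ ε₁ ε₂ x x' ε₂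
      decreasing⇒loss≤ε₂ x'≤x n = begin
        lossTerm f Δ ε₁ ε₂ x x' n   ≤⟨ lossTerm≤u*ε₁+v*ε₂ n 0ℚ 1ℚ (≤-trans D≤0 (≤-reflexive (sym (*-zeroˡ Δ))))
                                         (max0≤Δ (≤-trans (+-mono-≤ D≤0 (-d≤Δ n)) (≤-reflexive (+-identityˡ Δ)))) ⟩
        0ℚ * ε₁ + 1ℚ * ε₂           ≡⟨ solve 2 (λ a b → con 0ℚ :* a :+ con 1ℚ :* b , b) refl ε₁ ε₂ ⟩
        ε₂                          ∎
        where
        open ≤-Reasoning
        D≤0 : D n ≤ 0ℚ
        D≤0 = DeltaK-lub f x x' ≤-refl (λ i → p≤q⇒p-q≤0 (x'≤x i)) n

lemmaA8 : {X : Set} (Nbr : X → X → Set) → (∀ (x x' : X) → Nbr x x' → Nbr x' x) →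
    (f : Stream X) (Δ ε₁ ε₂ : ℚ) .{{_ : Positive Δ}} →
    HasSensitivity Nbr f Δ → 0ℚ < ε₁ → 0ℚ < ε₂ →
    (∀ (x x' : X) → Nbr x x' → LossBoundedBy f Δ ε₁ ε₂ x x' (ε₁ + (1ℚ + 1ℚ) * ε₂))
    × (Monotonic Nbr f → ∀ (x x' : X) → Nbr x x' →
         LossBoundedBy f Δ ε₁ ε₂ x x' (ε₁ + ε₂)
         × LossSumBoundedBy f Δ ε₁ ε₂ x x' (ε₁ + (1ℚ + 1ℚ) * ε₂))
lemmaA8 Nbr Nbr-sym f Δ ε₁ ε₂ sens 0<ε₁ 0<ε₂ =
  (λ x x' nbr → loss≤ε₁+2ε₂ x x' (∣d∣≤Δ x x' (Nbr-sym x x' nbr))) , monotone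
  where
  open Loss f Δ ε₁ ε₂ (<⇒≤ 0<ε₁) (<⇒≤ 0<ε₂)

  ∣d∣≤Δ : ∀ x x' → Nbr x' x → ∀ i → ∣ f i x' - f i x ∣ ≤ Δ
  ∣d∣≤Δ x x' nbr i = sens i x' x nbr

  ε₁+ε₂+ε₂≡ε₁+2ε₂ : ε₁ + ε₂ + ε₂ ≡ ε₁ + (1ℚ + 1ℚ) * ε₂
  ε₁+ε₂+ε₂≡ε₁+2ε₂ = solve 2 (λ a b → a :+ b :+ b , a :+ (con 1ℚ :+ con 1ℚ) :* b) refl ε₁ ε₂

  monotone : Monotonic Nbr f → ∀ x x' → Nbr x x' →
    LossBoundedBy f Δ ε₁ ε₂ x x' (ε₁ + ε₂) × LossSumBoundedBy f Δ ε₁ ε₂ x x' (ε₁ + (1ℚ + 1ℚ) * ε₂)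
  monotone mono x x' nbr with mono x x' nbr
  ... | inj₁ x≤x' =
    up , subst (LossSumBoundedBy f Δ ε₁ ε₂ x x') ε₁+ε₂+ε₂≡ε₁+2ε₂ (LossBoundedBy⇒LossSumBoundedBy x x' up down)
    where
    up : LossBoundedBy f Δ ε₁ ε₂ x x' (ε₁ + ε₂)
    up = increasing⇒loss≤ε₁+ε₂ x x' (∣d∣≤Δ x x' (Nbr-sym x x' nbr)) x≤x'
    down : LossBoundedBy f Δ ε₁ ε₂ x' x ε₂
    down = decreasing⇒loss≤ε₂ x' x (∣d∣≤Δ x' x nbr) x≤x'
  ... | inj₂ x'≤x =
    (λ n → ≤-trans (down n) (0≤p⇒q≤p+q ε₂ (<⇒≤ 0<ε₁))) ,
    subst (LossSumBoundedBy f Δ ε₁ ε₂ x x') (trans (+-comm ε₂ (ε₁ + ε₂)) ε₁+ε₂+ε₂≡ε₁+2ε₂)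
          (LossBoundedBy⇒LossSumBoundedBy x x' down up)
    where
    down : LossBoundedBy f Δ ε₁ ε₂ x x' ε₂
    down = decreasing⇒loss≤ε₂ x x' (∣d∣≤Δ x x' (Nbr-sym x x' nbr)) x'≤x
    up : LossBoundedBy f Δ ε₁ ε₂ x' x (ε₁ + ε₂)
    up = increasing⇒loss≤ε₁+ε₂ x' x (∣d∣≤Δ x' x nbr) x'≤x
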